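{- Any bipartite graph $G=(U,W,E)$ of sign-rank $d$ admits a partition $U=U_1\cup U_2$ such that the semi-induced bipartite graphs $G[U_1,W]$ and $G[U_2,W]$ are point-halfspace incidence graphs in $\mathbb{R}^{d-1}$.
   Context: The sign-rank of a bipartite graph $G=(U,W,E)$ (fixed bipartition) is the minimum rank of a real matrix $R\in\mathbb{R}^{U\times W}$ with all entries nonzero such that $R_{u,w}>0$ iff $uw\in E$. For disjoint $X,Y\subseteq V(G)$, $G[X,Y]$ is the bipartite graph on parts $X,Y$ with $x\in X$, $y\in Y$ adjacent iff they are adjacent in $G$. A halfspace in $\mathbb{R}^m$ is a set $\{x\in\mathbb{R}^m:\langle w,x\rangle\le t\}$ with $w\neq0$. For a set $P$ of points and a set $H$ of halfspaces in $\mathbb{R}^m$, the incidence graph $G(P,H)$ is the bipartite graph with parts $P,H$ and edges $ph$ for $p\in h$. A bipartite graph is a point-halfspace incidence graph in $\mathbb{R}^m$ if it is isomorphic to some $G(P,H)$ with $P$ a set of points and $H$ a set of halfspaces in $\mathbb{R}^m$ (with the first part corresponding to points and the second to halfspaces). -}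

module Defs where

open import Data.Nat using (ℕ; zero; suc; _≤_)
open import Data.Fin using (Fin)
open import Data.Bool using (Bool; true)
open import Data.Product using (Σ; _×_; _,_)
open import Data.Sum using (_⊎_)
open import Relation.Nullary using (¬_)
open import Relation.Binary.PropositionalEquality using (_≡_; _≢_)
open import Relation.Binary.Definitions using (Transitive; Trichotomous)
open import Algebra.Structures using (IsCommutativeRing)
open import Function.Bundles using (_⇔_)

-- A model of the real numbers: a Dedekind-complete ordered field
-- (with propositional equality as the field equality).
record RealField : Set₁ where
  infixl 6 _+_
  infixl 7 _*_
  infix 4 _<_
  field
    ℝ   : Set
    0# 1# : ℝ
    _+_ _*_ : ℝ → ℝ → ℝ
    -_  : ℝ → ℝ
    _<_ : ℝ → ℝ → Set
    isCommutativeRing : IsCommutativeRing _≡_ _+_ _*_ -_ 0# 1#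
    0≢1     : 0# ≢ 1#
    inverse : ∀ x → x ≢ 0# → Σ ℝ (λ y → x * y ≡ 1#)
    <-trans : Transitive _<_
    <-tri   : Trichotomous _≡_ _<_
    +-mono-< : ∀ {x y} z → x < y → x + z < y + z
    *-pos    : ∀ {x y} → 0# < x → 0# < y → 0# < x * y
    sup : (S : ℝ → Set) → Σ ℝ S → Σ ℝ (λ b → ∀ x → S x → x < b ⊎ x ≡ b) →
          Σ ℝ (λ s → (∀ x → S x → x < s ⊎ x ≡ s) ×
                     (∀ b → (∀ x → S x → x < b ⊎ x ≡ b) → s < b ⊎ s ≡ b))

module _ (RF : RealField) where
  open RealField RF

  _≤ᵣ_ : ℝ → ℝ → Set
  x ≤ᵣ y = x < y ⊎ x ≡ y

  ∑ : (k : ℕ) → (Fin k → ℝ) → ℝ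
  ∑ zero f = 0#
  ∑ (suc k) f = f Fin.zero + ∑ k (λ i → f (Fin.suc i))

  ⟨_,_⟩ : {k : ℕ} → (Fin k → ℝ) → (Fin k → ℝ) → ℝ
  ⟨_,_⟩ {k} x y = ∑ k (λ i → x i * y i)

  -- real matrices indexed by U = Fin m, W = Fin n
  Matrix : ℕ → ℕ → Set
  Matrix m n = Fin m → Fin n → ℝ

  RankAtMost : {m n : ℕ} → ℕ → Matrix m n → Set
  RankAtMost {m} {n} r M =
    Σ (Fin m → Fin r → ℝ) λ A → Σ (Fin n → Fin r → ℝ) λ B →
      ∀ u w → M u w ≡ ⟨ A u , B w ⟩

  SignRealizes : {m n : ℕ} → (Fin m → Fin n → Bool) → Matrix m n → Set
  SignRealizes E R = ∀ u w → (R u w ≢ 0#) × ((0# < R u w) ⇔ (E u w ≡ true))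

  SignRankIs : {m n : ℕ} → (Fin m → Fin n → Bool) → ℕ → Set
  SignRankIs {m} {n} E d =
    (Σ (Matrix m n) λ R → SignRealizes E R × RankAtMost d R) ×
    (∀ (R : Matrix m n) r → SignRealizes E R → RankAtMost r R → d ≤ r)

  record Halfspace (k : ℕ) : Set where
    field
      normal    : Fin k → ℝ
      threshold : ℝ
      nonzero   : ¬ (∀ i → normal i ≡ 0#)

  _∈H_ : {k : ℕ} → (Fin k → ℝ) → Halfspace k → Set
  x ∈H h = ⟨ Halfspace.normal h , x ⟩ ≤ᵣ Halfspace.threshold h

  -- the bipartite graph with parts A, B and adjacency adj is isomorphic to
  -- G(P,H) for a set P of points and a set H of halfspaces in ℝ^k
  -- (first part ↦ points, second part ↦ halfspaces, bijectively).
  IsPointHalfspaceGraph : (k : ℕ) {A B : Set} → (A → B → Bool) → Set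
  IsPointHalfspaceGraph k {A} {B} adj =
    Σ (A → Fin k → ℝ) λ p → Σ (B → Halfspace k) λ h →
      (∀ a a' → p a ≡ p a' → a ≡ a') ×
      (∀ b b' → (∀ x → (x ∈H h b) ⇔ (x ∈H h b')) → b ≡ b') ×
      (∀ a b → (adj a b ≡ true) ⇔ (p a ∈H h b))

-- semi-induced bipartite graph G[U_b, W] where U_b = {u | side u ≡ b}
semiInduced : {m n : ℕ} → (Fin m → Fin n → Bool) → (side : Fin m → Bool) → (b : Bool) →
              Σ (Fin m) (λ u → side u ≡ b) → Fin n → Bool
semiInduced E side b (u , _) w = E u w

{-# OPTIONS --safe #-}
-- Write a sign-realizing matrix of rank d as R u w = ⟨A u , B w⟩ with A u, B w ∈ ℝ^d.
-- Moving one coordinate of every row by ε·(u+1), with ε small, changes no sign of R and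
-- makes that coordinate nonzero and injective in u; scaling rows by positive reals changes
-- no sign either. Doing this to rows and columns we may assume A u 0 = ±1, B w 1 = ±1,
-- and that u ↦ A u 1 and w ↦ B w 0 are injective. On the rows with A u 0 = σ,
--   R u w = σ B w 0 + ⟨tail (A u) , tail (B w)⟩,
-- so R u w > 0 iff the point tail (A u) lies in the halfspace ⟨- tail (B w) , x⟩ ≤ σ B w 0
-- of ℝ^(d-1). Splitting the rows by σ gives the two incidence graphs. Since the normals
-- have first coordinate ±1, a halfspace determines its threshold σ B w 0, so the injective
-- coordinates make the points, resp. the halfspaces, pairwise distinct.
module Submission where

open import Defs
open import Data.Nat using (ℕ; _≤_; _∸_)
open import Data.Fin using (Fin)
open import Data.Bool using (Bool; true; false)
open import Data.Product using (Σ; _×_)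

open import Algebra.Bundles using (CommutativeRing)
open import Algebra.Structures using (IsCommutativeRing)
import Algebra.Construct.NaturalChoice.Min as NaturalChoiceMin
import Algebra.Properties.AbelianGroup as AbelianGroupProperties
import Algebra.Properties.CommutativeSemigroup as CommutativeSemigroupProperties
import Algebra.Properties.Ring as RingProperties
open import Data.Bool using (not)
open import Data.Empty using (⊥-elim)
open import Data.Fin using (toℕ)
open import Data.Fin.Properties using (toℕ-injective) renaming (_≟_ to _≟ᶠ_)
open import Data.Nat using (zero; suc; z≤n; s≤s) renaming (_<_ to _<ℕ_)
open import Data.Nat.Properties using (suc-injective; <-cmp; m≤n⇒m<n∨m≡n)
open import Data.Product using (_,_; proj₁; proj₂)
open import Data.Sum using (inj₁; inj₂)
open import Data.Vec.Functional using (Vector; updateAt; tail; _∷_; replicate)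
open import Data.Vec.Functional.Properties using (updateAt-updates; updateAt-minimal)
open import Function using (_∘_; flip; _⇔_; mk⇔; Equivalence)
import Function.Properties.Equivalence as ⇔
open import Relation.Binary using (IsStrictTotalOrder; TotalOrder; tri<; tri≈; tri>)
import Relation.Binary.Construct.StrictToNonStrict as StrictToNonStrict
open import Relation.Binary.Consequences using (tri⇒irr; tri⇒asym)
open import Relation.Binary.PropositionalEquality
open import Relation.Nullary using (¬_; yes; no)

module _ (RF : RealField) where
  open RealField RF
  open IsCommutativeRing isCommutativeRing
    using (+-assoc; +-comm; +-identityˡ; +-identityʳ; -‿inverseˡ; -‿inverseʳ;
           *-assoc; *-comm; *-identityˡ; *-identityʳ; distribˡ; distribʳ; zeroʳ)
  open ≡-Reasoning

  private
    variable
      m n k : ℕ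
      E : Fin m → Fin n → Bool
      x y z c : ℝ
      P Q : ℝ → Set

  commutativeRing : CommutativeRing _ _
  commutativeRing = record { isCommutativeRing = isCommutativeRing }

  open CommutativeRing commutativeRing using (ring; +-abelianGroup; +-commutativeSemigroup; _-_)
  open RingProperties ring using (-‿distribˡ-*; -‿distribʳ-*; x[y-z]≈xy-xz; -1*x≈-x)
  open AbelianGroupProperties +-abelianGroup using (⁻¹-∙-comm; ⁻¹-involutive; ⁻¹-injective; ε⁻¹≈ε)
    renaming (∙-cancelˡ to +-cancelˡ)
  open CommutativeSemigroupProperties +-commutativeSemigroup using (interchange; xy∙z≈xz∙y)

  infix 4 _≤ℝ_
  _≤ℝ_ : ℝ → ℝ → Set
  _≤ℝ_ = _≤ᵣ_ RF

  <-isStrictTotalOrder : IsStrictTotalOrder _≡_ _<_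
  <-isStrictTotalOrder = record
    { isStrictPartialOrder = record
      { isEquivalence = isEquivalence
      ; irrefl        = tri⇒irr <-tri
      ; trans         = <-trans
      ; <-resp-≈      = (λ { refl p → p }) , (λ { refl p → p }) }
    ; compare = <-tri }

  ≤-totalOrder : TotalOrder _ _ _
  ≤-totalOrder = record
    { isTotalOrder = StrictToNonStrict.isTotalOrder _≡_ _<_ <-isStrictTotalOrder }

  open TotalOrder ≤-totalOrder using () renaming (refl to ≤-refl; trans to ≤-trans; antisym to ≤-antisym)
  open NaturalChoiceMin ≤-totalOrder using (_⊓_; x⊓y≤x; x⊓y≤y; ⊓-sel)

  <-irrefl : ¬ x < x
  <-irrefl = tri⇒irr <-tri refl

  <-asym : x < y → ¬ y < x
  <-asym = tri⇒asym <-tri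

  <⇒≢ : x < y → x ≢ y
  <⇒≢ p refl = <-irrefl p

  <-≤-trans : x < y → y ≤ℝ z → x < z
  <-≤-trans p (inj₁ q) = <-trans p q
  <-≤-trans p (inj₂ refl) = p

  ≤-<-trans : x ≤ℝ y → y < z → x < z
  ≤-<-trans (inj₁ p) q = <-trans p q
  ≤-<-trans (inj₂ refl) q = q

  ≤∧≢⇒< : x ≤ℝ y → x ≢ y → x < y
  ≤∧≢⇒< (inj₁ p) _ = p
  ≤∧≢⇒< (inj₂ e) x≢y = ⊥-elim (x≢y e)

  ⊓-pos : 0# < x → 0# < y → 0# < x ⊓ y
  ⊓-pos {x} {y} p q with ⊓-sel x y
  ... | inj₁ e = subst (0# <_) (sym e) p
  ... | inj₂ e = subst (0# <_) (sym e) q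

  +-monoʳ-< : ∀ z → x < y → z + x < z + y
  +-monoʳ-< {x} {y} z p = subst₂ _<_ (+-comm x z) (+-comm y z) (+-mono-< z p)

  x<x+y : ∀ x → 0# < y → x < x + y
  x<x+y x p = subst (_< x + _) (+-identityʳ x) (+-monoʳ-< x p)

  y-x+x≡y : ∀ y x → (y - x) + x ≡ y
  y-x+x≡y y x = begin
    (y - x) + x    ≡⟨ +-assoc y (- x) x ⟩
    y + (- x + x)  ≡⟨ cong (y +_) (-‿inverseˡ x) ⟩
    y + 0#         ≡⟨ +-identityʳ y ⟩
    y              ∎

  x<y⇒0<y-x : x < y → 0# < y - x
  x<y⇒0<y-x {x} {y} p = subst (_< y - x) (-‿inverseʳ x) (+-mono-< (- x) p)

  0<y-x⇒x<y : 0# < y - x → x < y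
  0<y-x⇒x<y {y} {x} p = subst₂ _<_ (+-identityˡ x) (y-x+x≡y y x) (+-mono-< x p)

  0<x+y⇔-y<x : ∀ x y → (0# < x + y) ⇔ (- y < x)
  0<x+y⇔-y<x x y = mk⇔
    (λ p → subst₂ _<_ (+-identityˡ (- y)) (x+y-y≡x) (+-mono-< (- y) p))
    (λ p → subst (_< x + y) (-‿inverseˡ y) (+-mono-< y p))
    where
    x+y-y≡x : (x + y) - y ≡ x
    x+y-y≡x = trans (+-assoc x y (- y)) (trans (cong (x +_) (-‿inverseʳ y)) (+-identityʳ x))

  -‿antimono-< : x < y → - y < - x
  -‿antimono-< {x} {y} p = 0<y-x⇒x<y (subst (0# <_) y-x≡-x--y (x<y⇒0<y-x p))
    where
    y-x≡-x--y : y - x ≡ - x - (- y)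
    y-x≡-x--y = trans (+-comm y (- x)) (cong (- x +_) (sym (⁻¹-involutive y)))

  -‿antimono-≤ : x ≤ℝ y → - y ≤ℝ - x
  -‿antimono-≤ (inj₁ p) = inj₁ (-‿antimono-< p)
  -‿antimono-≤ (inj₂ refl) = inj₂ refl

  neg⇒-pos : x < 0# → 0# < - x
  neg⇒-pos p = subst (_< _) ε⁻¹≈ε (-‿antimono-< p)

  *-monoˡ-< : 0# < c → x < y → c * x < c * y
  *-monoˡ-< {c} {x} {y} pc p = 0<y-x⇒x<y (subst (0# <_) (x[y-z]≈xy-xz c y x) (*-pos pc (x<y⇒0<y-x p)))

  *-monoʳ-≤ : 0# < c → x ≤ℝ y → x * c ≤ℝ y * c
  *-monoʳ-≤ {c} {x} {y} pc (inj₁ p) = inj₁ (subst₂ _<_ (*-comm c x) (*-comm c y) (*-monoˡ-< pc p))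
  *-monoʳ-≤ pc (inj₂ refl) = inj₂ refl

  pos*neg<0 : 0# < c → x < 0# → c * x < 0#
  pos*neg<0 {c} pc p = subst (_ <_) (zeroʳ c) (*-monoˡ-< pc p)

  -1*-1≡1 : - 1# * - 1# ≡ 1#
  -1*-1≡1 = trans (-1*x≈-x (- 1#)) (⁻¹-involutive 1#)

  0<1 : 0# < 1#
  0<1 with <-tri 0# 1#
  ... | tri< p _ _ = p
  ... | tri≈ _ e _ = ⊥-elim (0≢1 e)
  ... | tri> _ _ p = ⊥-elim (<-asym p (subst (0# <_) -1*-1≡1 (*-pos (neg⇒-pos p) (neg⇒-pos p))))

  x<1+x : ∀ x → x < 1# + x
  x<1+x x = subst (_< 1# + x) (+-identityˡ x) (+-mono-< x 0<1)

  pos⇒inverse-pos : 0# < x → Σ ℝ λ y → 0# < y × x * y ≡ 1#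
  pos⇒inverse-pos {x} p with inverse x (λ e → <⇒≢ p (sym e))
  ... | y , xy≡1 with <-tri 0# y
  ...   | tri< 0<y _ _ = y , 0<y , xy≡1
  ...   | tri≈ _ refl _ = ⊥-elim (0≢1 (trans (sym (zeroʳ x)) xy≡1))
  ...   | tri> _ _ y<0 = ⊥-elim (<-asym 0<1 (subst (_< 0#) xy≡1 (pos*neg<0 p y<0)))

  *-cancelˡ-pos : 0# < c → c * x ≡ c * y → x ≡ y
  *-cancelˡ-pos {c} {x} {y} pc e with pos⇒inverse-pos pc
  ... | c⁻¹ , _ , cc⁻¹≡1 = begin
    x                ≡⟨ sym (cancel x) ⟩
    c⁻¹ * (c * x)    ≡⟨ cong (c⁻¹ *_) e ⟩
    c⁻¹ * (c * y)    ≡⟨ cancel y ⟩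
    y                ∎
    where
    cancel : ∀ z → c⁻¹ * (c * z) ≡ z
    cancel z = begin
      c⁻¹ * (c * z)  ≡⟨ sym (*-assoc c⁻¹ c z) ⟩
      (c⁻¹ * c) * z  ≡⟨ cong (_* z) (trans (*-comm c⁻¹ c) cc⁻¹≡1) ⟩
      1# * z         ≡⟨ *-identityˡ z ⟩
      z              ∎

  ±1 : Bool → ℝ
  ±1 true = 1#
  ±1 false = - 1#

  ±1*±1≡1 : ∀ b → ±1 b * ±1 b ≡ 1#
  ±1*±1≡1 true = *-identityˡ 1#
  ±1*±1≡1 false = -1*-1≡1

  ±1-cancel : ∀ b → ±1 b * x ≡ ±1 b * y → x ≡ y
  ±1-cancel {x} {y} b e = begin
    x                      ≡⟨ sym (unscale x) ⟩
    ±1 b * (±1 b * x)      ≡⟨ cong (±1 b *_) e ⟩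
    ±1 b * (±1 b * y)      ≡⟨ unscale y ⟩
    y                      ∎
    where
    unscale : ∀ z → ±1 b * (±1 b * z) ≡ z
    unscale z = trans (sym (*-assoc (±1 b) (±1 b) z)) (trans (cong (_* z) (±1*±1≡1 b)) (*-identityˡ z))

  -±1≡±1-not : ∀ b → - ±1 b ≡ ±1 (not b)
  -±1≡±1-not true = refl
  -±1≡±1-not false = ⁻¹-involutive 1#

  ±1≢0 : ∀ b → ±1 b ≢ 0#
  ±1≢0 true e = 0≢1 (sym e)
  ±1≢0 false e = 0≢1 (sym (⁻¹-injective (trans e (sym ε⁻¹≈ε))))

  normalisingFactor : x ≢ 0# → Σ ℝ λ c → 0# < c × Σ Bool λ b → c * x ≡ ±1 b
  normalisingFactor {x} x≢0 with <-tri 0# x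
  ... | tri≈ _ 0≡x _ = ⊥-elim (x≢0 (sym 0≡x))
  ... | tri< 0<x _ _ with pos⇒inverse-pos 0<x
  ...   | x⁻¹ , 0<x⁻¹ , xx⁻¹≡1 = x⁻¹ , 0<x⁻¹ , true , trans (*-comm x⁻¹ x) xx⁻¹≡1
  normalisingFactor {x} x≢0 | tri> _ _ x<0 with pos⇒inverse-pos (neg⇒-pos x<0)
  ...   | y , 0<y , -xy≡1 = y , 0<y , false , (begin
    y * x              ≡⟨ sym (⁻¹-involutive (y * x)) ⟩
    - (- (y * x))      ≡⟨ cong -_ (-‿distribʳ-* y x) ⟩
    - (y * - x)        ≡⟨ cong -_ (trans (*-comm y (- x)) -xy≡1) ⟩
    - 1#               ∎)

  SameSign : ℝ → ℝ → Set
  SameSign x y = (y ≢ 0#) × ((0# < x) ⇔ (0# < y))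

  sameSign-pos : 0# < x → 0# < y → SameSign x y
  sameSign-pos p q = (λ e → <⇒≢ q (sym e)) , mk⇔ (λ _ → q) (λ _ → p)

  sameSign-neg : x < 0# → y < 0# → SameSign x y
  sameSign-neg p q = <⇒≢ q , mk⇔ (λ p' → ⊥-elim (<-asym p p')) (λ q' → ⊥-elim (<-asym q q'))

  sameSign-*pos : 0# < c → x ≢ 0# → SameSign x (c * x)
  sameSign-*pos {c} {x} pc x≢0 with <-tri 0# x
  ... | tri< 0<x _ _ = sameSign-pos 0<x (*-pos pc 0<x)
  ... | tri≈ _ 0≡x _ = ⊥-elim (x≢0 (sym 0≡x))
  ... | tri> _ _ x<0 = sameSign-neg x<0 (pos*neg<0 pc x<0)

  fromℕ : ℕ → ℝ
  fromℕ zero = 0#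
  fromℕ (suc n) = 1# + fromℕ n

  fromℕ-strictMono : ∀ {i j} → i <ℕ j → fromℕ i < fromℕ j
  fromℕ-strictMono {i} {suc j} (s≤s i≤j) with m≤n⇒m<n∨m≡n i≤j
  ... | inj₁ i<j = <-trans (fromℕ-strictMono i<j) (x<1+x (fromℕ j))
  ... | inj₂ refl = x<1+x (fromℕ i)

  fromℕ-injective : ∀ {i j} → fromℕ i ≡ fromℕ j → i ≡ j
  fromℕ-injective {i} {j} e with <-cmp i j
  ... | tri< i<j _ _ = ⊥-elim (<⇒≢ (fromℕ-strictMono i<j) e)
  ... | tri≈ _ i≡j _ = i≡j
  ... | tri> _ _ j<i = ⊥-elim (<⇒≢ (fromℕ-strictMono j<i) (sym e))

  -- Perturbations by a sufficiently small ε

  Eventually : (ℝ → Set) → Set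
  Eventually P = Σ ℝ λ δ → 0# < δ × (∀ ε → 0# < ε → ε ≤ℝ δ → P ε)

  eventually-map : (∀ {ε} → P ε → Q ε) → Eventually P → Eventually Q
  eventually-map f (δ , 0<δ , p) = δ , 0<δ , λ ε 0<ε ε≤δ → f (p ε 0<ε ε≤δ)

  eventually-× : Eventually P → Eventually Q → Eventually (λ ε → P ε × Q ε)
  eventually-× (δ , 0<δ , p) (δ' , 0<δ' , q) = δ ⊓ δ' , ⊓-pos 0<δ 0<δ' , λ ε 0<ε ε≤ →
    p ε 0<ε (≤-trans ε≤ (x⊓y≤x δ δ')) , q ε 0<ε (≤-trans ε≤ (x⊓y≤y δ δ'))

  eventually-∀ : {P : Fin n → ℝ → Set} → (∀ i → Eventually (P i)) → Eventually (λ ε → ∀ i → P i ε)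
  eventually-∀ {zero} _ = 1# , 0<1 , λ _ _ _ ()
  eventually-∀ {suc n} {P} ev =
    eventually-map cons (eventually-× (ev Fin.zero) (eventually-∀ (ev ∘ Fin.suc)))
    where
    cons : ∀ {ε} → P Fin.zero ε × (∀ i → P (Fin.suc i) ε) → ∀ i → P i ε
    cons (p , _) Fin.zero = p
    cons (_ , ps) (Fin.suc i) = ps i

  eventually-witness : Eventually P → Σ ℝ λ ε → 0# < ε × P ε
  eventually-witness (δ , 0<δ , p) = δ , 0<δ , p δ 0<δ ≤-refl

  -- δ = x / (c + 1)
  ∃-small-multiple : 0# < x → 0# < c → Σ ℝ λ δ → 0# < δ × δ * c < x
  ∃-small-multiple {x} {c} 0<x 0<c with pos⇒inverse-pos (<-trans 0<c (subst (c <_) (+-comm 1# c) (x<1+x c)))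
  ... | i , 0<i , [c+1]i≡1 = δ , 0<δ , subst (δ * c <_) δ[c+1]≡x (x<x+y (δ * c) 0<δ)
    where
    δ = x * i
    0<δ = *-pos 0<x 0<i
    δ[c+1]≡x : δ * c + δ ≡ x
    δ[c+1]≡x = begin
      δ * c + δ           ≡⟨ cong (δ * c +_) (sym (*-identityʳ δ)) ⟩
      δ * c + δ * 1#      ≡⟨ sym (distribˡ δ c 1#) ⟩
      (x * i) * (c + 1#)  ≡⟨ *-assoc x i (c + 1#) ⟩
      x * (i * (c + 1#))  ≡⟨ cong (x *_) (trans (*-comm i (c + 1#)) [c+1]i≡1) ⟩
      x * 1#              ≡⟨ *-identityʳ x ⟩
      x                   ∎

  eventually-pos : ∀ c → 0# < x → Eventually (λ ε → 0# < x + ε * c)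
  eventually-pos {x} c 0<x with <-tri 0# c
  ... | tri< 0<c _ _ = 1# , 0<1 , λ ε 0<ε _ → <-trans 0<x (x<x+y x (*-pos 0<ε 0<c))
  ... | tri≈ _ refl _ = 1# , 0<1 , λ ε _ _ →
          subst (0# <_) (sym (trans (cong (x +_) (zeroʳ ε)) (+-identityʳ x))) 0<x
  ... | tri> _ _ c<0 with ∃-small-multiple 0<x (neg⇒-pos c<0)
  ...   | δ , 0<δ , δ[-c]<x = δ , 0<δ , λ ε 0<ε ε≤δ →
          subst (0# <_) (x-ε[-c]≡x+εc ε)
            (x<y⇒0<y-x (≤-<-trans (*-monoʳ-≤ (neg⇒-pos c<0) ε≤δ) δ[-c]<x))
    where
    x-ε[-c]≡x+εc : ∀ ε → x - ε * (- c) ≡ x + ε * c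
    x-ε[-c]≡x+εc ε = cong (x +_) (trans (cong -_ (sym (-‿distribʳ-* ε c))) (⁻¹-involutive (ε * c)))

  eventually-< : ∀ {a a'} c c' → a < a' → Eventually (λ ε → a + ε * c < a' + ε * c')
  eventually-< {a} {a'} c c' a<a' =
    eventually-map (λ {ε} p → 0<y-x⇒x<y (subst (0# <_) (rearrange ε) p))
                   (eventually-pos (c' - c) (x<y⇒0<y-x a<a'))
    where
    rearrange : ∀ ε → (a' - a) + ε * (c' - c) ≡ (a' + ε * c') - (a + ε * c)
    rearrange ε = begin
      (a' - a) + ε * (c' - c)           ≡⟨ cong ((a' - a) +_) (x[y-z]≈xy-xz ε c' c) ⟩
      (a' - a) + (ε * c' - ε * c)       ≡⟨ interchange a' (- a) (ε * c') (- (ε * c)) ⟩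
      (a' + ε * c') + (- a - ε * c)     ≡⟨ cong ((a' + ε * c') +_) (⁻¹-∙-comm a (ε * c)) ⟩
      (a' + ε * c') - (a + ε * c)       ∎

  0+ε*0≡0 : ∀ ε → 0# + ε * 0# ≡ 0#
  0+ε*0≡0 ε = trans (+-identityˡ (ε * 0#)) (zeroʳ ε)

  eventually-sameSign : ∀ c → x ≢ 0# → Eventually (λ ε → SameSign x (x + ε * c))
  eventually-sameSign {x} c x≢0 with <-tri 0# x
  ... | tri< 0<x _ _ = eventually-map (sameSign-pos 0<x) (eventually-pos c 0<x)
  ... | tri≈ _ 0≡x _ = ⊥-elim (x≢0 (sym 0≡x))
  ... | tri> _ _ x<0 =
    eventually-map (λ {ε} p → sameSign-neg x<0 (subst (_ <_) (0+ε*0≡0 ε) p)) (eventually-< c 0# x<0)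

  eventually-≢ : ∀ {c c'} a a' → c ≢ c' → Eventually (λ ε → a + ε * c ≢ a' + ε * c')
  eventually-≢ {c} {c'} a a' c≢c' with <-tri a a'
  ... | tri< a<a' _ _ = eventually-map <⇒≢ (eventually-< c c' a<a')
  ... | tri> _ _ a'<a = eventually-map (λ p e → <⇒≢ p (sym e)) (eventually-< c' c a'<a)
  ... | tri≈ _ refl _ = 1# , 0<1 , λ ε 0<ε _ e → c≢c' (*-cancelˡ-pos 0<ε (+-cancelˡ a _ _ e))

  infix 7 _·_
  _·_ : Vector ℝ k → Vector ℝ k → ℝ
  a · b = ⟨_,_⟩ RF a b

  ∑-cong : ∀ {f g : Fin k → ℝ} → (∀ i → f i ≡ g i) → ∑ RF k f ≡ ∑ RF k g
  ∑-cong {zero} _ = refl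
  ∑-cong {suc k} f≗g = cong₂ _+_ (f≗g Fin.zero) (∑-cong (f≗g ∘ Fin.suc))

  ∑-zero : ∑ RF k (λ _ → 0#) ≡ 0#
  ∑-zero {zero} = refl
  ∑-zero {suc k} = trans (cong (0# +_) (∑-zero {k})) (+-identityʳ 0#)

  ∑-*ˡ : ∀ c (f : Fin k → ℝ) → ∑ RF k (λ i → c * f i) ≡ c * ∑ RF k f
  ∑-*ˡ {zero} c f = sym (zeroʳ c)
  ∑-*ˡ {suc k} c f = trans (cong (c * f Fin.zero +_) (∑-*ˡ c (f ∘ Fin.suc))) (sym (distribˡ c _ _))

  ∑-neg : ∀ (f : Fin k → ℝ) → ∑ RF k (λ i → - f i) ≡ - ∑ RF k f
  ∑-neg {zero} f = sym ε⁻¹≈ε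
  ∑-neg {suc k} f = trans (cong (- f Fin.zero +_) (∑-neg (f ∘ Fin.suc))) (⁻¹-∙-comm _ _)

  ·-comm : ∀ (a b : Vector ℝ k) → a · b ≡ b · a
  ·-comm a b = ∑-cong (λ i → *-comm (a i) (b i))

  ·-zeroʳ : ∀ (a : Vector ℝ k) → a · replicate k 0# ≡ 0#
  ·-zeroʳ {k} a = trans (∑-cong (λ i → zeroʳ (a i))) (∑-zero {k})

  ·-*ˡ : ∀ c (a b : Vector ℝ k) → (λ i → c * a i) · b ≡ c * (a · b)
  ·-*ˡ c a b = trans (∑-cong (λ i → *-assoc c (a i) (b i))) (∑-*ˡ c (λ i → a i * b i))

  ·-negˡ : ∀ (a b : Vector ℝ k) → (λ i → - a i) · b ≡ - (a · b)
  ·-negˡ a b = trans (∑-cong (λ i → sym (-‿distribˡ-* (a i) (b i)))) (∑-neg (λ i → a i * b i))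

  ·-updateAt : ∀ (a b : Vector ℝ k) j δ → updateAt a j (_+ δ) · b ≡ a · b + δ * b j
  ·-updateAt a b Fin.zero δ = begin
    (a Fin.zero + δ) * b Fin.zero + tail a · tail b
      ≡⟨ cong (_+ tail a · tail b) (distribʳ (b Fin.zero) (a Fin.zero) δ) ⟩
    (a Fin.zero * b Fin.zero + δ * b Fin.zero) + tail a · tail b
      ≡⟨ xy∙z≈xz∙y _ _ _ ⟩
    a · b + δ * b Fin.zero
      ∎
  ·-updateAt a b (Fin.suc j) δ =
    trans (cong (a Fin.zero * b Fin.zero +_) (·-updateAt (tail a) (tail b) j δ)) (sym (+-assoc _ _ _))

  Gram : (Fin m → Vector ℝ k) → (Fin n → Vector ℝ k) → Matrix RF m n
  Gram A B u w = A u · B w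

  signRealizes-≗ : ∀ {R R' : Matrix RF m n} → SignRealizes RF E R → (∀ u w → R u w ≡ R' u w) →
    SignRealizes RF E R'
  signRealizes-≗ {E = E} real R≗R' u w =
    subst (λ r → (r ≢ 0#) × ((0# < r) ⇔ (E u w ≡ true))) (R≗R' u w) (real u w)

  signRealizes-sameSign : ∀ {R R' : Matrix RF m n} → SignRealizes RF E R →
    (∀ u w → R u w ≢ 0# → SameSign (R u w) (R' u w)) → SignRealizes RF E R'
  signRealizes-sameSign real same u w with real u w
  ... | R≢0 , pos⇔edge with same u w R≢0
  ...   | R'≢0 , pos⇔pos' = R'≢0 , ⇔.trans (⇔.sym pos⇔pos') pos⇔edge

  signRealizes-transpose : ∀ {A : Fin m → Vector ℝ k} {B : Fin n → Vector ℝ k} →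
    SignRealizes RF E (Gram A B) → SignRealizes RF (flip E) (Gram B A)
  signRealizes-transpose {A = A} {B} real = signRealizes-≗ (flip real) (λ w u → ·-comm (A u) (B w))

  signRealizes-scaleRows : ∀ {A : Fin m → Vector ℝ k} {B : Fin n → Vector ℝ k} (c : Fin m → ℝ) →
    (∀ u → 0# < c u) → SignRealizes RF E (Gram A B) → SignRealizes RF E (Gram (λ u i → c u * A u i) B)
  signRealizes-scaleRows {A = A} {B} c 0<c real = signRealizes-sameSign real λ u w R≢0 →
    subst (SameSign _) (sym (·-*ˡ (c u) (A u) (B w))) (sameSign-*pos (0<c u) R≢0)

  signRealizes-shiftRows : ∀ {A : Fin m → Vector ℝ k} {B : Fin n → Vector ℝ k} j (δ : Fin m → ℝ) →
    SignRealizes RF E (Gram A B) → (∀ u w → SameSign (A u · B w) (A u · B w + δ u * B w j)) →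
    SignRealizes RF E (Gram (λ u → updateAt (A u) j (_+ δ u)) B)
  signRealizes-shiftRows {A = A} {B} j δ real same = signRealizes-sameSign real λ u w _ →
    subst (SameSign _) (sym (·-updateAt (A u) (B w) j (δ u))) (same u w)

  label : Fin m → ℝ
  label u = fromℕ (suc (toℕ u))

  label≢0 : ∀ (u : Fin m) → label u ≢ 0#
  label≢0 u e = <⇒≢ (fromℕ-strictMono {0} {suc (toℕ u)} (s≤s z≤n)) (sym e)

  label-injective : ∀ {u u' : Fin m} → label u ≡ label u' → u ≡ u'
  label-injective = toℕ-injective ∘ suc-injective ∘ fromℕ-injective

  separatingShift : ∀ {A : Fin m → Vector ℝ k} {B : Fin n → Vector ℝ k} (j : Fin k) →
    SignRealizes RF E (Gram A B) → Σ ℝ λ ε →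
      (∀ u w → SameSign (A u · B w) (A u · B w + (ε * label u) * B w j)) ×
      (∀ u → A u j + ε * label u ≢ 0#) ×
      (∀ u u' → A u j + ε * label u ≡ A u' j + ε * label u' → u ≡ u')
  separatingShift {m = m} {A = A} {B} j real =
    let ε , _ , properties = eventually-witness (eventually-× signs (eventually-× nonzero injective))
    in ε , properties
    where
    signs : Eventually (λ ε → ∀ u w → SameSign (A u · B w) (A u · B w + (ε * label u) * B w j))
    signs = eventually-∀ λ u → eventually-∀ λ w →
      eventually-map (λ {ε} → subst (λ y → SameSign (A u · B w) (A u · B w + y))
                                    (sym (*-assoc ε (label u) (B w j))))
                     (eventually-sameSign (label u * B w j) (proj₁ (real u w)))
    nonzero : Eventually (λ ε → ∀ u → A u j + ε * label u ≢ 0#)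
    nonzero = eventually-∀ λ u →
      eventually-map (λ {ε} ≢0+ε*0 e → ≢0+ε*0 (trans e (sym (0+ε*0≡0 ε))))
                     (eventually-≢ (A u j) 0# (label≢0 u))
    distinct : ∀ (u u' : Fin m) → Eventually (λ ε → A u j + ε * label u ≡ A u' j + ε * label u' → u ≡ u')
    distinct u u' with u ≟ᶠ u'
    ... | yes u≡u' = 1# , 0<1 , λ _ _ _ _ → u≡u'
    ... | no u≢u' =
      eventually-map (λ ≢ e → ⊥-elim (≢ e)) (eventually-≢ (A u j) (A u' j) (u≢u' ∘ label-injective))
    injective : Eventually (λ ε → ∀ u u' → A u j + ε * label u ≡ A u' j + ε * label u' → u ≡ u')
    injective = eventually-∀ λ u → eventually-∀ λ u' → distinct u u'

  separate : ∀ {A : Fin m → Vector ℝ k} {B : Fin n → Vector ℝ k} (j : Fin k) →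
    SignRealizes RF E (Gram A B) → Σ (Fin m → Vector ℝ k) λ A' → SignRealizes RF E (Gram A' B) ×
      (∀ u → A' u j ≢ 0#) × (∀ u u' → A' u j ≡ A' u' j → u ≡ u') × (∀ u i → i ≢ j → A' u i ≡ A u i)
  separate {A = A} j real with separatingShift j real
  ... | ε , same , nonzero , injective =
    A' , signRealizes-shiftRows j (λ u → ε * label u) real same ,
    (λ u → subst (_≢ 0#) (sym (A'-j u)) (nonzero u)) ,
    (λ u u' e → injective u u' (trans (sym (A'-j u)) (trans e (A'-j u')))) ,
    (λ u i i≢j → updateAt-minimal i j (A u) i≢j)
    where
    A' = λ u → updateAt (A u) j (_+ ε * label u)
    A'-j : ∀ u → A' u j ≡ A u j + ε * label u
    A'-j u = updateAt-updates j (A u)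

  rescale : ∀ {A : Fin m → Vector ℝ k} {B : Fin n → Vector ℝ k} (j : Fin k) →
    SignRealizes RF E (Gram A B) → (∀ u → A u j ≢ 0#) →
    Σ (Fin m → Vector ℝ k) λ A' → SignRealizes RF E (Gram A' B) ×
      Σ (Fin m → Bool) λ side → ∀ u → A' u j ≡ ±1 (side u)
  rescale {A = A} j real A-j≢0 =
    (λ u i → factor u * A u i) ,
    signRealizes-scaleRows {A = A} factor (proj₁ ∘ proj₂ ∘ normalising) real ,
    (proj₁ ∘ proj₂ ∘ proj₂ ∘ normalising) , (proj₂ ∘ proj₂ ∘ proj₂ ∘ normalising)
    where
    normalising = λ u → normalisingFactor (A-j≢0 u)
    factor = proj₁ ∘ normalising

  record Normalised (A : Fin m → Vector ℝ k) (j j' : Fin k) : Set where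
    field
      side      : Fin m → Bool
      unit      : ∀ u → A u j ≡ ±1 (side u)
      injective : ∀ u u' → A u j' ≡ A u' j' → u ≡ u'

  normalise : ∀ {A : Fin m → Vector ℝ k} {B : Fin n → Vector ℝ k} {j j'} → j ≢ j' →
    SignRealizes RF E (Gram A B) →
    Σ (Fin m → Vector ℝ k) λ A' → SignRealizes RF E (Gram A' B) × Normalised A' j j'
  normalise {j = j} {j'} j≢j' real with separate j real
  ... | _ , real₁ , nonzero₁ , _ , _ with rescale j real₁ nonzero₁
  ...   | _ , real₂ , side , unit₂ with separate j' real₂
  ...     | A₃ , real₃ , _ , injective₃ , unchanged₃ =
    A₃ , real₃ , record
      { side = side ; unit = λ u → trans (unchanged₃ u j j≢j') (unit₂ u) ; injective = injective₃ }

  -- Halfspaces and the incidence graphs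

  probe : ℝ → Vector ℝ (suc k)
  probe r = r ∷ replicate _ 0#

  ·-probe : ∀ (c : Vector ℝ (suc k)) r → c · probe r ≡ c Fin.zero * r
  ·-probe c r = trans (cong (c Fin.zero * r +_) (·-zeroʳ (tail c))) (+-identityʳ _)

  threshold-mono : ∀ (c c' : Vector ℝ (suc k)) {t t'} b → c Fin.zero ≡ ±1 b → c' Fin.zero ≡ ±1 b →
    (∀ x → c · x ≤ℝ t → c' · x ≤ℝ t') → t ≤ℝ t'
  threshold-mono c c' {t} {t'} b c₀ c'₀ ⊆ =
    subst (_≤ℝ t') (·-probe-t c' c'₀)
      (⊆ (probe (±1 b * t)) (subst (_≤ℝ t) (sym (·-probe-t c c₀)) ≤-refl))
    where
    ·-probe-t : ∀ d → d Fin.zero ≡ ±1 b → d · probe (±1 b * t) ≡ t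
    ·-probe-t d d₀ = begin
      d · probe (±1 b * t)     ≡⟨ ·-probe d (±1 b * t) ⟩
      d Fin.zero * (±1 b * t)  ≡⟨ cong (_* (±1 b * t)) d₀ ⟩
      ±1 b * (±1 b * t)        ≡⟨ sym (*-assoc (±1 b) (±1 b) t) ⟩
      (±1 b * ±1 b) * t        ≡⟨ cong (_* t) (±1*±1≡1 b) ⟩
      1# * t                   ≡⟨ *-identityˡ t ⟩
      t                        ∎

  -- The probe r = t ⊓ -(1 + t') lies in the first halfspace but not in the second.
  opposite-⊈ : ∀ (c c' : Vector ℝ (suc k)) {t t'} → c Fin.zero ≡ 1# → c' Fin.zero ≡ - 1# →
    ¬ (∀ x → c · x ≤ℝ t → c' · x ≤ℝ t')
  opposite-⊈ c c' {t} {t'} c₀ c'₀ ⊆ = <-irrefl (≤-<-trans 1+t'≤-r (≤-<-trans -r≤t' (x<1+x t')))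
    where
    r = t ⊓ - (1# + t')
    c·r≡r : c · probe r ≡ r
    c·r≡r = trans (·-probe c r) (trans (cong (_* r) c₀) (*-identityˡ r))
    c'·r≡-r : c' · probe r ≡ - r
    c'·r≡-r = trans (·-probe c' r) (trans (cong (_* r) c'₀) (-1*x≈-x r))
    -r≤t' : - r ≤ℝ t'
    -r≤t' = subst (_≤ℝ t') c'·r≡-r (⊆ (probe r) (subst (_≤ℝ t) (sym c·r≡r) (x⊓y≤x t _)))
    1+t'≤-r : 1# + t' ≤ℝ - r
    1+t'≤-r = subst (_≤ℝ - r) (⁻¹-involutive (1# + t')) (-‿antimono-≤ (x⊓y≤y t _))

  threshold-unique : ∀ (c c' : Vector ℝ (suc k)) {t t'} s s' → c Fin.zero ≡ ±1 s → c' Fin.zero ≡ ±1 s' →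
    (∀ x → (c · x ≤ℝ t) ⇔ (c' · x ≤ℝ t')) → t ≡ t'
  threshold-unique c c' true true c₀ c'₀ same = ≤-antisym
    (threshold-mono c c' true c₀ c'₀ (Equivalence.to ∘ same))
    (threshold-mono c' c true c'₀ c₀ (Equivalence.from ∘ same))
  threshold-unique c c' false false c₀ c'₀ same = ≤-antisym
    (threshold-mono c c' false c₀ c'₀ (Equivalence.to ∘ same))
    (threshold-mono c' c false c'₀ c₀ (Equivalence.from ∘ same))
  threshold-unique c c' true false c₀ c'₀ same =
    ⊥-elim (opposite-⊈ c c' c₀ c'₀ (Equivalence.to ∘ same))
  threshold-unique c c' false true c₀ c'₀ same =
    ⊥-elim (opposite-⊈ c' c c'₀ c₀ (Equivalence.from ∘ same))

  pointHalfspaceGraph : ∀ {A : Fin m → Vector ℝ (suc (suc k))} {B : Fin n → Vector ℝ (suc (suc k))} →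
    SignRealizes RF E (Gram A B) → (NA : Normalised A Fin.zero (Fin.suc Fin.zero)) →
    Normalised B (Fin.suc Fin.zero) Fin.zero →
    ∀ b → IsPointHalfspaceGraph RF (suc k) (semiInduced E (Normalised.side NA) b)
  pointHalfspaceGraph {E = E} {A = A} {B = B} real NA NB b =
    point , halfspace , point-injective , halfspace-injective , incidence
    where
    open Normalised NA
    open Normalised NB using () renaming (side to sideB; unit to unitB; injective to injectiveB)

    point : Σ _ (λ u → side u ≡ b) → Vector ℝ _
    point (u , _) = tail (A u)

    normal : ∀ w → Vector ℝ _
    normal w i = - B w (Fin.suc i)

    threshold : ∀ w → ℝ
    threshold w = ±1 b * B w Fin.zero

    normal₀ : ∀ w → normal w Fin.zero ≡ ±1 (not (sideB w))
    normal₀ w = trans (cong -_ (unitB w)) (-±1≡±1-not (sideB w))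

    halfspace : ∀ w → Halfspace RF _
    halfspace w = record
      { normal = normal w
      ; threshold = threshold w
      ; nonzero = λ normal≡0 → ±1≢0 (not (sideB w)) (trans (sym (normal₀ w)) (normal≡0 Fin.zero)) }

    point-injective : ∀ a a' → point a ≡ point a' → a ≡ a'
    point-injective (u , refl) (u' , e) p≡p' with injective u u' (cong (λ p → p Fin.zero) p≡p')
    ... | refl with e
    ...   | refl = refl

    halfspace-injective : ∀ w w' →
      (∀ x → (_∈H_ RF x (halfspace w)) ⇔ (_∈H_ RF x (halfspace w'))) → w ≡ w'
    halfspace-injective w w' same = injectiveB w w' (±1-cancel b (threshold-unique
      (normal w) (normal w') (not (sideB w)) (not (sideB w')) (normal₀ w) (normal₀ w') same))

    incidence : ∀ a w → (semiInduced E side b a w ≡ true) ⇔ (_∈H_ RF (point a) (halfspace w))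
    incidence (u , e) w =
      ⇔.trans edge⇔0<θ+Y (⇔.trans (0<x+y⇔-y<x θ Y)
        (subst (λ r → (- Y < θ) ⇔ (r ≤ℝ θ)) (sym normal·point) -Y<θ⇔-Y≤θ))
      where
      θ = threshold w
      Y = point (u , e) · tail (B w)
      split : A u · B w ≡ θ + Y
      split = cong (λ a₀ → a₀ * B w Fin.zero + Y) (trans (unit u) (cong ±1 e))
      edge⇔0<θ+Y : (E u w ≡ true) ⇔ (0# < θ + Y)
      edge⇔0<θ+Y = subst (λ r → (E u w ≡ true) ⇔ (0# < r)) split (⇔.sym (proj₂ (real u w)))
      -Y<θ⇔-Y≤θ : (- Y < θ) ⇔ (- Y ≤ℝ θ)
      -Y<θ⇔-Y≤θ = mk⇔ inj₁ λ -Y≤θ → ≤∧≢⇒< -Y≤θ λ -Y≡θ →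
        proj₁ (real u w) (trans split (trans (cong (_+ Y) (sym -Y≡θ)) (-‿inverseˡ Y)))
      normal·point : normal w · point (u , e) ≡ - Y
      normal·point =
        trans (·-negˡ (tail (B w)) (point (u , e))) (cong -_ (·-comm (tail (B w)) (point (u , e))))

  pointHalfspacePartition : ∀ {R : Matrix RF m n} → SignRealizes RF E R → RankAtMost RF (suc (suc k)) R →
    Σ (Fin m → Bool) λ side →
      IsPointHalfspaceGraph RF (suc k) (semiInduced E side true) ×
      IsPointHalfspaceGraph RF (suc k) (semiInduced E side false)
  -- The row and column families are given explicitly: inferring them from a Gram matrix at
  -- the concrete dimension suc (suc k) makes the unifier unfold ∑ and run out of memory.
  pointHalfspacePartition realR (A , B , R≡AB) =
    let A' , real₁ , NA = normalise {A = A} {B} {Fin.zero} {Fin.suc Fin.zero} (λ ())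
                                    (signRealizes-≗ {R' = Gram A B} realR R≡AB)
        B' , realᵀ , NB = normalise {A = B} {A'} {Fin.suc Fin.zero} {Fin.zero} (λ ())
                                    (signRealizes-transpose {A = A'} {B = B} real₁)
        real = signRealizes-transpose {A = B'} {B = A'} realᵀ
        graph = pointHalfspaceGraph {A = A'} {B'} real NA NB
    in Normalised.side NA , graph true , graph false

proposition4p4 : (RF : RealField) (m n : ℕ) (E : Fin m → Fin n → Bool) (d : ℕ) →
    2 ≤ d → SignRankIs RF E d →
    Σ (Fin m → Bool) λ side →
      IsPointHalfspaceGraph RF (d ∸ 1) (semiInduced E side true) ×
      IsPointHalfspaceGraph RF (d ∸ 1) (semiInduced E side false)
proposition4p4 RF m n E (suc (suc k)) (s≤s (s≤s z≤n)) ((R , realR , rankR) , _) =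
  pointHalfspacePartition RF realR rankR
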